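{- Let $(G,\mathcal{H})$ be a cross-free graph system of genus $g$ and let $\mathcal{K}$ be a collection of connected subgraphs of $G$. Suppose $G$ contains no $\mathcal{K}$-vertex. Then a dual support $Q^*$ for $(G,\mathcal{H})$ of genus $g$ satisfying the special edge property is also an intersection support for $(G,\mathcal{H},\mathcal{K})$.
   Context: $G$ is connected and $\mathcal{H}$ consists of connected induced subgraphs. Reduced graph $R(H,H')$: contract all edges with both endpoints in $V(H)\cap V(H')$; $H,H'$ are cross-free at $v\in V(H)\cap V(H')$ if in $R(H,H')$ there are no four edges $\{\tilde v,v_i\}$ around the image $\tilde v$ of $v$, in cyclic order $i=1,\dots,4$, with $v_1,v_3\in V(H)\setminus V(H')$, $v_2,v_4\in V(H')\setminus V(H)$. Cross-free graph system of genus $g$: $G$ has genus $g$ and an embedding on an orientable surface of genus $g$ in which all pairs in $\mathcal{H}$ are cross-free at all common vertices. $\mathcal{H}_v=\{H: v\in V(H)\}$, $\mathcal{K}_v$ similarly; a $\mathcal{K}$-vertex is $v$ with $\mathcal{H}_v=\emptyset$ and $\mathcal{K}_v\neq\emptyset$. Dual support: graph on $\mathcal{H}$ where each $\mathcal{H}_v$ induces a connected subgraph. Special edge: $\{u,v\}\in E(G)$ with $\mathcal{H}_u,\mathcal{H}_v\neq\emptyset$, $\mathcal{H}_u\cap\mathcal{H}_v=\emptyset$; special edge property: for each special edge some $H\in\mathcal{H}_u$, $H'\in\mathcal{H}_v$ are adjacent. Intersection support: graph on $\mathcal{H}$ in which, for every $K\in\mathcal{K}$, $\{H\in\mathcal{H}: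 V(H)\cap V(K)\neq\emptyset\}$ induces a connected subgraph. -}

module Defs where

open import Data.Nat using (ℕ; zero; suc; _+_; _*_; _≤_; _<_; _≡ᵇ_)
open import Data.Fin using (Fin)
import Data.Fin as F
open import Data.Bool using (Bool; true; false; if_then_else_; _∧_)
open import Data.Product using (Σ; ∃; _×_; _,_; proj₁; proj₂)
open import Relation.Binary.PropositionalEquality using (_≡_; _≢_)
open import Relation.Nullary using (¬_)
open import Function using (_∘_)

sumFin : ∀ {n} → (Fin n → ℕ) → ℕ
sumFin {zero}  f = 0
sumFin {suc n} f = f F.zero + sumFin (f ∘ F.suc)

countFin : ∀ {n} → (Fin n → Bool) → ℕ
countFin P = sumFin (λ i → if P i then 1 else 0)

iter : ∀ {A : Set} → (A → A) → ℕ → A → A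
iter f zero    a = a
iter f (suc j) a = f (iter f j a)

data Reach {n : ℕ} (E : Fin n → Fin n → Set) : Fin n → Fin n → Set where
  here : ∀ {u} → Reach E u u
  step : ∀ {u v w} → E u v → Reach E v w → Reach E u w

NumClasses : (A : Set) → (A → A → Set) → ℕ → Set
NumClasses A R k =
  Σ (Fin k → A) λ rep →
    (∀ i j → R (rep i) (rep j) → i ≡ j) × (∀ a → ∃ λ i → R a (rep i))

record Graph (n : ℕ) : Set where
  field
    adj     : Fin n → Fin n → Bool
    adj-sym : ∀ u v → adj u v ≡ adj v u
    irrefl  : ∀ u → adj u u ≡ false
open Graph public

Edge : ∀ {n} → Graph n → Fin n → Fin n → Set
Edge G u v = adj G u v ≡ true

InducesConnected : ∀ {n} → Graph n → (Fin n → Set) → Set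
InducesConnected G P =
  ∀ a b → P a → P b → Reach (λ x y → Edge G x y × P x × P y) a b

Connected : ∀ {n} → Graph n → Set
Connected {n} G = Fin n × (∀ u v → Reach (Edge G) u v)

ConnectedInduced : ∀ {n} → Graph n → (Fin n → Bool) → Set
ConnectedInduced G S =
  (∃ λ v → S v ≡ true) × InducesConnected G (λ v → S v ≡ true)

record Subgraph {n : ℕ} (G : Graph n) : Set where
  field
    vs       : Fin n → Bool
    es       : Fin n → Fin n → Bool
    es-sym   : ∀ u v → es u v ≡ es v u
    es-sub   : ∀ u v → es u v ≡ true → Edge G u v
    es-ends  : ∀ u v → es u v ≡ true → (vs u ≡ true) × (vs v ≡ true)
open Subgraph public

ConnectedSubgraph : ∀ {n} {G : Graph n} → Subgraph G → Set
ConnectedSubgraph K =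
  (∃ λ v → vs K v ≡ true) ×
  (∀ a b → vs K a ≡ true → vs K b ≡ true → Reach (λ x y → es K x y ≡ true) a b)

-- Embeddings in orientable surfaces = rotation systems

record Rotation {n : ℕ} (G : Graph n) : Set where
  field
    σ        : Fin n → Fin n → Fin n
    σ-nbr    : ∀ v u → Edge G v u → Edge G v (σ v u)
    σ-cyclic : ∀ v u w → Edge G v u → Edge G v w → ∃ λ j → iter (σ v) j u ≡ w
open Rotation public

Dart : ∀ {n} → Graph n → Set
Dart {n} G = Σ (Fin n × Fin n) λ p → Edge G (proj₁ p) (proj₂ p)

faceStep : ∀ {n} {G : Graph n} → Rotation G → Fin n × Fin n → Fin n × Fin n
faceStep ρ (u , v) = (v , σ ρ v u)

numDarts : ∀ {n} → Graph n → ℕ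
numDarts G = sumFin (λ u → countFin (adj G u))

degree : ∀ {n} → Graph n → Fin n → ℕ
degree G v = countFin (adj G v)

numIsolated : ∀ {n} → Graph n → ℕ
numIsolated G = countFin (λ v → degree G v ≡ᵇ 0)

-- the rotation system ρ is a (not necessarily cellular when G is
-- disconnected) embedding of G in the orientable surface of genus g:
-- Euler:  V − E + F = 2c − 2g, where F = number of face-tracing orbits
-- of darts + number of isolated vertices (each isolated vertex has its
-- own face), c = number of connected components.  Written in ℕ with
-- numDarts = 2E and everything doubled.
EmbGenus : ∀ {n} {G : Graph n} → Rotation G → ℕ → Set
EmbGenus {n} {G} ρ g =
  Σ ℕ λ f → Σ ℕ λ c →
    NumClasses (Dart G) (λ d d' → ∃ λ j → iter (faceStep ρ) j (proj₁ d) ≡ proj₁ d') f ×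
    NumClasses (Fin n) (Reach (Edge G)) c ×
    (2 * n + 2 * (f + numIsolated G) + 4 * g ≡ 4 * c + numDarts G)

HasGenus : ∀ {n} → Graph n → ℕ → Set
HasGenus G g =
  (∃ λ (ρ : Rotation G) → EmbGenus ρ g) ×
  (∀ (ρ : Rotation G) g' → EmbGenus ρ g' → g ≤ g')

EmbeddableInGenus : ∀ {n} → Graph n → ℕ → Set
EmbeddableInGenus G g = Σ (Rotation G) λ ρ → Σ ℕ λ g' → EmbGenus ρ g' × g' ≤ g

-- T is a spanning tree of the subgraph of G induced by C:
-- symmetric edges of G inside C, connected on C, with |C| − 1 edges.
SpanningTree : ∀ {n} → Graph n → (Fin n → Bool) → (Fin n → Fin n → Bool) → Set
SpanningTree G C T =
  (∀ u w → T u w ≡ T w u) ×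
  (∀ u w → T u w ≡ true → Edge G u w × C u ≡ true × C w ≡ true) ×
  (∀ u w → C u ≡ true → C w ≡ true → Reach (λ a b → T a b ≡ true) u w) ×
  (sumFin (λ u → countFin (T u)) + 2 ≡ 2 * countFin C)

-- walk around the contracted tree T: state (x , y) = "at x, looking at
-- the edge towards y"; rotate at x, and if the next edge is a tree edge,
-- traverse it (contraction merges the rotations).  Non-tree edges inside
-- C become loops and are simply passed over.
treeWalk : ∀ {n} {G : Graph n} → Rotation G → (Fin n → Fin n → Bool) →
           Fin n × Fin n → Fin n × Fin n
treeWalk ρ T (x , y) with σ ρ x y
... | z = if T x z then (z , x) else (x , z)

-- In the reduced graph R(H,H'), the component C of G[V(H) ∩ V(H')]
-- (contracted along the spanning tree T) has around its image four
-- edges to v₁,v₂,v₃,v₄ in cyclic order with v₁,v₃ ∈ H∖H', v₂,v₄ ∈ H'∖H.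
Crossing : ∀ {n} {G : Graph n} → Rotation G → (Fin n → Bool) →
           (Fin n → Fin n → Bool) → (Fin n → Bool) → (Fin n → Bool) → Set
Crossing {n} {G} ρ C T H H' =
  Σ (Fin n × Fin n) λ d₁ → Σ ℕ λ j₂ → Σ ℕ λ j₃ → Σ ℕ λ j₄ →
    C (proj₁ d₁) ≡ true × Edge G (proj₁ d₁) (proj₂ d₁) ×
    0 < j₂ × j₂ < j₃ × j₃ < j₄ ×
    (∀ i → 0 < i → i ≤ j₄ → iter (treeWalk ρ T) i d₁ ≢ d₁) ×
    In  (proj₂ d₁) ×
    In' (proj₂ (iter (treeWalk ρ T) j₂ d₁)) ×
    In  (proj₂ (iter (treeWalk ρ T) j₃ d₁)) ×
    In' (proj₂ (iter (treeWalk ρ T) j₄ d₁))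
  where
    In  : Fin n → Set
    In  u = H u ≡ true × H' u ≡ false
    In' : Fin n → Set
    In' u = H' u ≡ true × H u ≡ false

CrossFreeAt : ∀ {n} {G : Graph n} → Rotation G →
              (Fin n → Bool) → (Fin n → Bool) → Fin n → Set
CrossFreeAt {n} {G} ρ H H' v =
  ∀ (C : Fin n → Bool) →
    (∀ u → (C u ≡ true → Reach I v u) × (Reach I v u → C u ≡ true)) →
    ∀ (T : Fin n → Fin n → Bool) → SpanningTree G C T →
    ¬ Crossing ρ C T H H'
  where
    I : Fin n → Fin n → Set
    I a b = Edge G a b × (H a ∧ H' a) ≡ true × (H b ∧ H' b) ≡ true

CrossFreeSystem : ∀ {n m} → Graph n → (Fin m → Fin n → Bool) → ℕ → Set
CrossFreeSystem G H g =
  Connected G ×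
  (∀ a → ConnectedInduced G (H a)) ×
  HasGenus G g ×
  (Σ (Rotation G) λ ρ → EmbGenus ρ g ×
     (∀ a b v → H a v ≡ true → H b v ≡ true → CrossFreeAt ρ (H a) (H b) v))

NoKVertex : ∀ {n m k} {G : Graph n} → (Fin m → Fin n → Bool) → (Fin k → Subgraph G) → Set
NoKVertex H K =
  ∀ v → ¬ ((∀ a → H a v ≡ false) × (∃ λ j → vs (K j) v ≡ true))

DualSupport : ∀ {n m} → Graph n → (Fin m → Fin n → Bool) → Graph m → Set
DualSupport G H Q = ∀ v → InducesConnected Q (λ a → H a v ≡ true)

SpecialEdgeProperty : ∀ {n m} → Graph n → (Fin m → Fin n → Bool) → Graph m → Set
SpecialEdgeProperty G H Q =
  ∀ u v → Edge G u v →
    (∃ λ a → H a u ≡ true) → (∃ λ b → H b v ≡ true) →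
    (∀ a → ¬ (H a u ≡ true × H a v ≡ true)) →
    ∃ λ a → ∃ λ b → H a u ≡ true × H b v ≡ true × Edge Q a b

IntersectionSupport : ∀ {n m k} {G : Graph n} → (Fin m → Fin n → Bool) →
                      (Fin k → Subgraph G) → Graph m → Set
IntersectionSupport H K Q =
  ∀ j → InducesConnected Q (λ a → ∃ λ u → H a u ≡ true × vs (K j) u ≡ true)

{-# OPTIONS --safe #-}
-- Follow a walk u₀ u₁ … u_r of K.  Every uᵢ lies in some member of 𝓗 (no
-- 𝓚-vertex), and the members containing uᵢ are linked in Q through members
-- containing uᵢ (dual support).  Across an edge uᵢuᵢ₊₁ either some member
-- contains both ends, or the edge is special and Q has an edge from 𝓗_{uᵢ}
-- to 𝓗_{uᵢ₊₁}.  Every member used meets K, so the walk in Q stays inside the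
-- members meeting K.
module Submission where

open import Defs
open import Data.Nat using (ℕ)
open import Data.Fin using (Fin)
open import Data.Fin.Properties using (any?)
open import Data.Bool using (Bool; true; _≟_)
open import Data.Bool.Properties using (¬-not)
open import Data.Empty using (⊥-elim)
open import Data.Product using (∃; _×_; _,_; proj₂)
open import Relation.Binary.PropositionalEquality using (_≡_)
open import Relation.Nullary using (yes; no)
open import Relation.Nullary.Decidable using (_×-dec_)

module _ {n : ℕ} {E : Fin n → Fin n → Set} where

  _◅◅_ : ∀ {a b c} → Reach E a b → Reach E b c → Reach E a c
  here     ◅◅ q = q
  step e p ◅◅ q = step e (p ◅◅ q)

  Reach-map : ∀ {E′ : Fin n → Fin n → Set} → (∀ {x y} → E x y → E′ x y) →
              ∀ {a b} → Reach E a b → Reach E′ a b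
  Reach-map f here       = here
  Reach-map f (step e p) = step (f e) (Reach-map f p)

WalkIn : ∀ {m} → Graph m → (Fin m → Set) → Fin m → Fin m → Set
WalkIn Q P = Reach (λ x y → Edge Q x y × P x × P y)

Meets : ∀ {n m} → (Fin m → Fin n → Bool) → (Fin n → Bool) → Fin m → Set
Meets H S a = ∃ λ u → H a u ≡ true × S u ≡ true

NoKVertex⇒occupied : ∀ {n m k} {G : Graph n} {H : Fin m → Fin n → Bool} {K : Fin k → Subgraph G} →
           NoKVertex H K → ∀ j {v} → vs (K j) v ≡ true → ∃ λ a → H a v ≡ true
NoKVertex⇒occupied {H = H} noK j {v} kv with any? (λ a → H a v ≟ true)
... | yes found = found
... | no none   = ⊥-elim (noK v ((λ a → ¬-not (λ ha → none (a , ha))) , (j , kv)))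

module SupportWalks {n m : ℕ} (G : Graph n) (H : Fin m → Fin n → Bool) (Q : Graph m)
                    (dual : DualSupport G H Q) (special : SpecialEdgeProperty G H Q) where

  dual-walk : ∀ (S : Fin n → Bool) {v a b} → S v ≡ true → H a v ≡ true → H b v ≡ true →
              WalkIn Q (Meets H S) a b
  dual-walk S {v} sv ha hb =
    Reach-map (λ (e , hx , hy) → e , (v , hx , sv) , (v , hy , sv))
              (dual v _ _ ha hb)

  edge-walk : ∀ (S : Fin n → Bool) {u v a} → Edge G u v → S u ≡ true → S v ≡ true →
              H a u ≡ true → ∃ (λ b → H b v ≡ true) →
              ∃ λ c → H c v ≡ true × WalkIn Q (Meets H S) a c
  edge-walk S {u} {v} {a} uv su sv ha v-occupied
    with any? (λ c → (H c u ≟ true) ×-dec (H c v ≟ true))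
  ... | yes (c , hcu , hcv) = c , hcv , dual-walk S su ha hcu
  ... | no none =
    let (a′ , b′ , ha′ , hb′ , a′b′) =
          special u v uv (a , ha) v-occupied (λ c both → none (c , both))
    in b′ , hb′ , dual-walk S su ha ha′ ◅◅ step (a′b′ , (u , ha′ , su) , (v , hb′ , sv)) here

  walk-along-subgraph : ∀ (K : Subgraph G) → (∀ {v} → vs K v ≡ true → ∃ λ a → H a v ≡ true) →
    ∀ {u w a b} → Reach (λ x y → es K x y ≡ true) u w → vs K u ≡ true →
    H a u ≡ true → H b w ≡ true → WalkIn Q (Meets H (vs K)) a b
  walk-along-subgraph K covered here ku ha hb = dual-walk (vs K) ku ha hb
  walk-along-subgraph K covered (step {u} {x} ux rest) ku ha hb =
    let (_ , kx) = es-ends K u x ux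
        (c , hc , a⇝c) = edge-walk (vs K) (es-sub K u x ux) ku kx ha (covered kx)
    in a⇝c ◅◅ walk-along-subgraph K covered rest kx hc hb

lemma8 : ∀ {n m k : ℕ} (g : ℕ) (G : Graph n) (H : Fin m → Fin n → Bool) (K : Fin k → Subgraph G) →
    CrossFreeSystem G H g →
    (∀ j → ConnectedSubgraph (K j)) →
    NoKVertex H K →
    (Q : Graph m) → DualSupport G H Q → EmbeddableInGenus Q g → SpecialEdgeProperty G H Q →
    IntersectionSupport H K Q
lemma8 g G H K _ K-connected noK Q dual _ special j a b (u , hau , ku) (w , hbw , kw) =
  walk-along-subgraph (K j) (NoKVertex⇒occupied {K = K} noK j) (proj₂ (K-connected j) u w ku kw) ku hau hbw
  where open SupportWalks G H Q dual special
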